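{- For every natural number $n$ and all formulae $\psi,\gamma$ not containing $\vee$: if $\psi\vdash\gamma$, $\psi^2\vdash\gamma$, \ldots, $\psi^n\vdash\gamma$ and $\psi^n,\psi^+\vdash\gamma$ are all derivable in $\mathbf{ACT}^\wedge$, then $\psi^+\vdash\gamma$ is derivable in $\mathbf{ACT}^\wedge$.
   Context: Formulae are built from propositional variables and constants $\mathbf{0},\mathbf{1}$ using binary connectives $\cdot$, $\backslash$, $/$, $\vee$, $\wedge$ and unary ${}^*$; $\psi^+$ abbreviates $\psi\cdot\psi^*$, and in an antecedent $\psi^k$ denotes $k$ consecutive copies of $\psi$. A sequent is $\Gamma\vdash\beta$ with $\Gamma$ a finite, possibly empty (denoted $\Lambda$), sequence of formulae. The calculus $\mathbf{ACT}^\wedge$ (action logic without $\vee$) has axioms $\alpha\vdash\alpha$, $\Gamma,\mathbf{0},\Delta\vdash\gamma$, $\Lambda\vdash\mathbf{1}$, $\Lambda\vdash\alpha^*$, and rules: from $\Gamma,\Delta\vdash\gamma$ infer $\Gamma,\mathbf{1},\Delta\vdash\gamma$; from $\Pi\vdash\alpha$ and $\Gamma,\beta,\Delta\vdash\gamma$ infer $\Gamma,\Pi,\alpha\backslash\beta,\Delta\vdash\gamma$ and also $\Gamma,\beta/\alpha,\Pi,\Delta\vdash\gamma$; from $\alpha,\Pi\vdash\beta$ infer $\Pi\vdash\alpha\backslash\beta$; from $\Pi,\alpha\vdash\beta$ infer $\Pi\vdash\beta/\alpha$; from $\Gamma,\alpha,\beta,\Delta\vdash\gamma$ infer $\Gamma,\alpha\cdot\beta,\Delta\vdash\gamma$;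 from $\Gamma\vdash\alpha$ and $\Delta\vdash\beta$ infer $\Gamma,\Delta\vdash\alpha\cdot\beta$; from $\Gamma,\alpha_i,\Delta\vdash\gamma$ ($i=1,2$) infer $\Gamma,\alpha_1\wedge\alpha_2,\Delta\vdash\gamma$; from $\Pi\vdash\alpha_1$ and $\Pi\vdash\alpha_2$ infer $\Pi\vdash\alpha_1\wedge\alpha_2$; from $\Lambda\vdash\beta$ and $\alpha,\beta\vdash\beta$ infer $\alpha^*\vdash\beta$; cut (from $\Pi\vdash\alpha$ and $\Gamma,\alpha,\Delta\vdash\gamma$ infer $\Gamma,\Pi,\Delta\vdash\gamma$); from $\Pi\vdash\alpha$ and $\Delta\vdash\alpha^*$ infer $\Pi,\Delta\vdash\alpha^*$. All formulae involved are $\vee$-free. -}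

module Defs where

open import Data.Nat using (ℕ; zero; suc)
open import Data.List using (List; []; _∷_; _++_; [_])
open import Data.List.Relation.Unary.All using (All)

infixr 30 _·_
infixr 25 _∧_ _∨_
infixr 20 _＼_
infixl 20 _／_

data Fm : Set where
  var  : ℕ → Fm
  𝟘 𝟙  : Fm
  _·_  : Fm → Fm → Fm
  _＼_ : Fm → Fm → Fm
  _／_ : Fm → Fm → Fm
  _∨_  : Fm → Fm → Fm
  _∧_  : Fm → Fm → Fm
  _⋆   : Fm → Fm

data VFree : Fm → Set where
  var  : ∀ n → VFree (var n)
  𝟘    : VFree 𝟘
  𝟙    : VFree 𝟙
  _·_  : ∀ {a b} → VFree a → VFree b → VFree (a · b)
  _＼_ : ∀ {a b} → VFree a → VFree b → VFree (a ＼ b)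
  _／_ : ∀ {a b} → VFree a → VFree b → VFree (a ／ b)
  _∧_  : ∀ {a b} → VFree a → VFree b → VFree (a ∧ b)
  _⋆   : ∀ {a} → VFree a → VFree (a ⋆)

_⁺ : Fm → Fm
ψ ⁺ = ψ · (ψ ⋆)

copies : ℕ → Fm → List Fm
copies zero    ψ = []
copies (suc k) ψ = ψ ∷ copies k ψ

All-VFree : List Fm → Set
All-VFree Γ = All VFree Γ

infix 2 _⊢_

-- All formulae occurring in a derivation are
-- required to be ∨-free; since every rule except cut has the subformula
-- property, it suffices to demand ∨-freeness of the formulae introduced by
-- axioms and of the cut formula (the conclusions of the other rules are then
-- ∨-free whenever their premises are, and the formulae introduced by rules
-- are built from ∨-free premise material or carry an explicit VFree proof).
data _⊢_ : List Fm → Fm → Set where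
  ax     : ∀ {α} → VFree α → [ α ] ⊢ α
  ax𝟘    : ∀ {Γ Δ γ} → All-VFree Γ → All-VFree Δ → VFree γ →
           Γ ++ 𝟘 ∷ Δ ⊢ γ
  ax𝟙    : [] ⊢ 𝟙
  ax⋆    : ∀ {α} → VFree α → [] ⊢ α ⋆
  𝟙L     : ∀ {Γ Δ γ} → Γ ++ Δ ⊢ γ → Γ ++ 𝟙 ∷ Δ ⊢ γ
  ＼L    : ∀ {Π Γ Δ α β γ} → Π ⊢ α → Γ ++ β ∷ Δ ⊢ γ →
           Γ ++ Π ++ (α ＼ β) ∷ Δ ⊢ γ
  ／L    : ∀ {Π Γ Δ α β γ} → Π ⊢ α → Γ ++ β ∷ Δ ⊢ γ →
           Γ ++ (β ／ α) ∷ Π ++ Δ ⊢ γ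
  ＼R    : ∀ {Π α β} → α ∷ Π ⊢ β → Π ⊢ α ＼ β
  ／R    : ∀ {Π α β} → Π ++ [ α ] ⊢ β → Π ⊢ β ／ α
  ·L     : ∀ {Γ Δ α β γ} → Γ ++ α ∷ β ∷ Δ ⊢ γ → Γ ++ (α · β) ∷ Δ ⊢ γ
  ·R     : ∀ {Γ Δ α β} → Γ ⊢ α → Δ ⊢ β → Γ ++ Δ ⊢ α · β
  ∧L₁    : ∀ {Γ Δ α₁ α₂ γ} → VFree α₂ → Γ ++ α₁ ∷ Δ ⊢ γ →
           Γ ++ (α₁ ∧ α₂) ∷ Δ ⊢ γ
  ∧L₂    : ∀ {Γ Δ α₁ α₂ γ} → VFree α₁ → Γ ++ α₂ ∷ Δ ⊢ γ →
           Γ ++ (α₁ ∧ α₂) ∷ Δ ⊢ γ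
  ∧R     : ∀ {Π α₁ α₂} → Π ⊢ α₁ → Π ⊢ α₂ → Π ⊢ α₁ ∧ α₂
  ⋆ind   : ∀ {α β} → [] ⊢ β → α ∷ β ∷ [] ⊢ β → [ α ⋆ ] ⊢ β
  cut    : ∀ {Π Γ Δ α γ} → VFree α → Π ⊢ α → Γ ++ α ∷ Δ ⊢ γ →
           Γ ++ Π ++ Δ ⊢ γ
  ⋆R     : ∀ {Π Δ α} → Π ⊢ α → Δ ⊢ α ⋆ → Π ++ Δ ⊢ α ⋆

-- Put δₘ := ψ* ∧ (ψ \ γ) ∧ (ψ² \ γ) ∧ ⋯ ∧ (ψᵐ \ γ).  Then ψ* ⊢ δₙ by star
-- induction: Λ ⊢ δₙ is the hypotheses ψᵏ ⊢ γ for 1 ≤ k ≤ n, and ψ, δₙ ⊢ δₙ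
-- holds because ψᵏ, ψ, δₙ ⊢ γ follows from the conjunct ψᵏ⁺¹ \ γ of δₙ when
-- k < n, and from the conjunct ψ* together with ψⁿ, ψ⁺ ⊢ γ when k = n.
-- For n ≥ 1 the conjunct ψ \ γ then turns ψ, ψ* ⊢ δₙ into ψ, ψ* ⊢ γ; for
-- n = 0 the last hypothesis already is ψ⁺ ⊢ γ.
module Submission where

open import Defs
open import Data.Nat using (ℕ; _≤_; _<_; zero; suc; s≤s; z≤n)
open import Data.Nat.Properties using (m<1+n⇒m<n∨m≡n; m≤n⇒m<n∨m≡n; m<n⇒m<1+n; n<1+n)
open import Data.List using (List; []; _∷_; _++_; [_])
open import Data.List.Properties using (++-identityʳ)
open import Data.List.Relation.Unary.All using (All; []; _∷_)
open import Data.Sum using (inj₁; inj₂)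
open import Relation.Binary.PropositionalEquality using (_≡_; refl; subst; sym; cong)

-- Π ＼＼ β is the residual (π₁ ⋯ πₖ) \ β, written as πₖ \ (⋯ \ (π₁ \ β)).
infixr 20 _＼＼_

_＼＼_ : List Fm → Fm → Fm
[] ＼＼ β = β
(α ∷ Π) ＼＼ β = Π ＼＼ (α ＼ β)

＼＼-VFree : ∀ {Π β} → All VFree Π → VFree β → VFree (Π ＼＼ β)
＼＼-VFree [] vβ = vβ
＼＼-VFree (vα ∷ vΠ) vβ = ＼＼-VFree vΠ (vα ＼ vβ)

＼＼R : ∀ Π {Σ β} → Π ++ Σ ⊢ β → Σ ⊢ Π ＼＼ β
＼＼R [] d = d
＼＼R (α ∷ Π) d = ＼＼R Π (＼R d)

＼＼L : ∀ {Π β} → All VFree Π → VFree β → Π ++ [ Π ＼＼ β ] ⊢ β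
＼＼L [] vβ = ax vβ
＼＼L {α ∷ Π} {β} (vα ∷ vΠ) vβ =
  subst (λ Σ → α ∷ Σ ⊢ β) (++-identityʳ (Π ++ [ Π ＼＼ (α ＼ β) ]))
    (cut {Γ = [ α ]} {Δ = []} (vα ＼ vβ) (＼＼L vΠ (vα ＼ vβ))
      (＼L {Π = [ α ]} {Γ = []} {Δ = []} (ax vα) (ax vβ)))

·L⁻¹ : ∀ {Γ Δ α β γ} → VFree α → VFree β →
       Γ ++ α · β ∷ Δ ⊢ γ → Γ ++ α ∷ β ∷ Δ ⊢ γ
·L⁻¹ vα vβ d = cut (vα · vβ) (·R {Γ = [ _ ]} (ax vα) (ax vβ)) d

copies-VFree : ∀ k {ψ} → VFree ψ → All VFree (copies k ψ)
copies-VFree zero vψ = []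
copies-VFree (suc k) vψ = vψ ∷ copies-VFree k vψ

copies-++-∷ : ∀ k ψ Σ → copies k ψ ++ ψ ∷ Σ ≡ ψ ∷ copies k ψ ++ Σ
copies-++-∷ zero ψ Σ = refl
copies-++-∷ (suc k) ψ Σ = cong (ψ ∷_) (copies-++-∷ k ψ Σ)

module _ {ψ γ : Fm} (vψ : VFree ψ) (vγ : VFree γ) where

  invariant : ℕ → Fm
  invariant zero = ψ ⋆
  invariant (suc m) = invariant m ∧ (copies (suc m) ψ ＼＼ γ)

  ＼＼γ-VFree : ∀ k → VFree (copies k ψ ＼＼ γ)
  ＼＼γ-VFree k = ＼＼-VFree (copies-VFree k vψ) vγ

  invariant-VFree : ∀ m → VFree (invariant m)
  invariant-VFree zero = vψ ⋆
  invariant-VFree (suc m) = invariant-VFree m ∧ ＼＼γ-VFree (suc m)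

  invariant⊢⋆ : ∀ m → [ invariant m ] ⊢ ψ ⋆
  invariant⊢⋆ zero = ax (vψ ⋆)
  invariant⊢⋆ (suc m) = ∧L₁ {Γ = []} {Δ = []} (＼＼γ-VFree (suc m)) (invariant⊢⋆ m)

  invariant⊢＼＼ : ∀ {k m} → k < m → [ invariant m ] ⊢ copies (suc k) ψ ＼＼ γ
  invariant⊢＼＼ {k} {suc m} k<1+m with m<1+n⇒m<n∨m≡n k<1+m
  ... | inj₁ k<m = ∧L₁ {Γ = []} {Δ = []} (＼＼γ-VFree (suc m)) (invariant⊢＼＼ k<m)
  ... | inj₂ refl = ∧L₂ {Γ = []} {Δ = []} (invariant-VFree m) (ax (＼＼γ-VFree (suc m)))

  invariantL : ∀ {k m} → k < m → copies (suc k) ψ ++ [ invariant m ] ⊢ γ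
  invariantL {k} k<m =
    cut {Γ = copies (suc k) ψ} {Δ = []} (＼＼γ-VFree (suc k)) (invariant⊢＼＼ k<m)
      (＼＼L (copies-VFree (suc k) vψ) vγ)

  invariantR : ∀ {Σ} m → Σ ⊢ ψ ⋆ → (∀ k → k < m → copies (suc k) ψ ++ Σ ⊢ γ) →
               Σ ⊢ invariant m
  invariantR zero ⊢⋆ ⊢γ = ⊢⋆
  invariantR (suc m) ⊢⋆ ⊢γ =
    ∧R (invariantR m ⊢⋆ (λ k k<m → ⊢γ k (m<n⇒m<1+n k<m)))
       (＼＼R (copies (suc m) ψ) (⊢γ m (n<1+n m)))

  ⋆⊢invariant : ∀ n → (∀ k → 1 ≤ k → k ≤ n → copies k ψ ⊢ γ) →
                copies n ψ ++ [ ψ ⁺ ] ⊢ γ → [ ψ ⋆ ] ⊢ invariant n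
  ⋆⊢invariant n ψᵏ⊢γ ψⁿψ⁺⊢γ = ⋆ind empty⊢invariant ψ,invariant⊢invariant
    where
    empty⊢invariant : [] ⊢ invariant n
    empty⊢invariant = invariantR n (ax⋆ vψ) λ k k<n →
      subst (_⊢ γ) (sym (++-identityʳ (copies (suc k) ψ))) (ψᵏ⊢γ (suc k) (s≤s z≤n) k<n)

    ψ,invariant⊢⋆ : ψ ∷ invariant n ∷ [] ⊢ ψ ⋆
    ψ,invariant⊢⋆ = ⋆R {Π = [ ψ ]} (ax vψ) (invariant⊢⋆ n)

    ψⁿ,ψ,invariant⊢γ : copies n ψ ++ ψ ∷ invariant n ∷ [] ⊢ γ
    ψⁿ,ψ,invariant⊢γ =
      ·L⁻¹ vψ (invariant-VFree n)
        (cut (vψ · (vψ ⋆)) (·L {Γ = []} (·R {Γ = [ ψ ]} (ax vψ) (invariant⊢⋆ n)))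
          ψⁿψ⁺⊢γ)

    ψᵏ,ψ,invariant⊢γ : ∀ k → k < n → copies (suc k) ψ ++ ψ ∷ invariant n ∷ [] ⊢ γ
    ψᵏ,ψ,invariant⊢γ k 1+k≤n with m≤n⇒m<n∨m≡n 1+k≤n
    ... | inj₁ 1+k<n =
      subst (_⊢ γ) (sym (copies-++-∷ (suc k) ψ [ invariant n ])) (invariantL 1+k<n)
    ... | inj₂ refl = ψⁿ,ψ,invariant⊢γ

    ψ,invariant⊢invariant : ψ ∷ invariant n ∷ [] ⊢ invariant n
    ψ,invariant⊢invariant = invariantR n ψ,invariant⊢⋆ ψᵏ,ψ,invariant⊢γ

lemma12 : (n : ℕ) (ψ γ : Fm) → VFree ψ → VFree γ →
    (∀ k → 1 ≤ k → k ≤ n → copies k ψ ⊢ γ) →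
    copies n ψ ++ [ ψ ⁺ ] ⊢ γ →
    [ ψ ⁺ ] ⊢ γ
lemma12 zero ψ γ vψ vγ ψᵏ⊢γ ψⁿψ⁺⊢γ = ψⁿψ⁺⊢γ
lemma12 (suc n) ψ γ vψ vγ ψᵏ⊢γ ψⁿψ⁺⊢γ =
  ·L {Γ = []} {Δ = []}
    (cut {Γ = [ ψ ]} {Δ = []} (invariant-VFree vψ vγ (suc n))
      (⋆⊢invariant vψ vγ (suc n) ψᵏ⊢γ ψⁿψ⁺⊢γ)
      (invariantL vψ vγ (s≤s z≤n)))
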